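{- Let $p\ge5$ be a prime, and set $t=1$ if $p\equiv1\pmod6$ and $t=2$ if $p\equiv5\pmod6$. Let $k$ be an integer with $0\le k\le\frac{tp-1}{3}$. Then the power series expansion at $x=0$ of the rational function $\frac{(\frac13-x)_k}{(1+x)_k}$ lies in $\mathbb{Z}_p[[x]]$ and can be written as $$\frac{\left(\frac13-x\right)_k}{(1+x)_k}=\frac{\left(\frac13\right)_k}{(1)_k}\Big[1+a_{k,1}x+a_{k,2}x^2+\cdots\Big]$$ with coefficients $a_{k,i}\in\mathbb{Z}_p$.
   Context: For $a$ a number or an element of a polynomial ring and $k\ge0$ an integer, $(a)_k=a(a+1)\cdots(a+k-1)$ with $(a)_0=1$. -}

module Defs where

open import Data.Nat as ℕ using (ℕ; zero; suc; _%_; _≡ᵇ_)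
open import Data.Nat.Divisibility using (_∣_)
open import Data.Nat.Coprimality using (1-coprimeTo; sym)
open import Data.Integer as ℤ using (+_)
open import Data.Rational as ℚ using (ℚ; mkℚ; 0ℚ; 1ℚ; _+_; _*_; -_; _/_; 1/_; NonZero; Positive; NonNegative)
open import Data.Rational.Properties using (pos⇒nonZero; pos*pos⇒pos; pos+nonNeg⇒pos)
open import Data.List using (List; []; _∷_; map; zipWith; upTo; foldr)
open import Data.Bool using (if_then_else_)
open import Relation.Nullary using (¬_)

ofℕ : ℕ → ℚ
ofℕ n = mkℚ (+ n) 0 (sym (1-coprimeTo n))

⅓ : ℚ
⅓ = + 1 / 3

sumℚ : List ℚ → ℚ
sumℚ = foldr _+_ 0ℚ

-- q ∈ ℚ lies in ℤ_p (i.e. ℚ ∩ ℤ_p): p does not divide the reduced denominator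
pIntegral : ℕ → ℚ → Set
pIntegral p q = ¬ (p ∣ ℚ.denominatorℕ q)

Series : Set
Series = ℕ → ℚ

cst : ℚ → Series
cst c zero = c
cst c (suc n) = 0ℚ

lin : ℚ → ℚ → Series
lin c d zero = c
lin c d (suc zero) = d
lin c d (suc (suc n)) = 0ℚ

_⊕_ : Series → Series → Series
(f ⊕ g) n = f n + g n

_⊛_ : Series → Series → Series
(f ⊛ g) n = sumℚ (map (λ i → f i * g (n ℕ.∸ i)) (upTo (suc n)))

pochS : Series → ℕ → Series
pochS a zero = cst 1ℚ
pochS a (suc k) = pochS a k ⊛ (a ⊕ cst (ofℕ k))

pochℚ : ℚ → ℕ → ℚ
pochℚ a zero = 1ℚ
pochℚ a (suc k) = pochℚ a k * (a + ofℕ k)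

-- Multiplicative inverse of a power series with invertible constant term:
-- b_0 = 1/s_0,  b_n = -(1/s_0) * Σ_{i=1}^{n} s_i b_{n-i}
module Inverse (s : Series) (u : ℚ) where
  -- next n [b_{n-1}, …, b_0] = b_n
  next : ℕ → List ℚ → ℚ
  next zero l = u
  next (suc m) l = - (u * sumℚ (zipWith _*_ (map (λ i → s (suc i)) (upTo (suc m))) l))

  -- revPrefix n = [b_{n-1}, …, b_0]
  revPrefix : ℕ → List ℚ
  revPrefix zero = []
  revPrefix (suc n) = next n (revPrefix n) ∷ revPrefix n

  coeff : Series
  coeff n = next n (revPrefix n)

invSeries : (s : Series) → .{{NonZero (s 0)}} → Series
invSeries s = Inverse.coeff s (1/ (s 0))

ofℕ-nonNeg : ∀ n → NonNegative (ofℕ n)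
ofℕ-nonNeg n = _

1+ofℕ-pos : ∀ n → Positive (1ℚ + ofℕ n)
1+ofℕ-pos n = pos+nonNeg⇒pos 1ℚ {{_}} (ofℕ n) {{ofℕ-nonNeg n}}

pochℚ1-pos : ∀ k → Positive (pochℚ 1ℚ k)
pochℚ1-pos zero = _
pochℚ1-pos (suc k) = pos*pos⇒pos (pochℚ 1ℚ k) {{pochℚ1-pos k}} (1ℚ + ofℕ k) {{1+ofℕ-pos k}}

pochS-den0-pos : ∀ k → Positive (pochS (lin 1ℚ 1ℚ) k 0)
pochS-den0-pos zero = _
pochS-den0-pos (suc k) =
  pos+nonNeg⇒pos (pochS (lin 1ℚ 1ℚ) k 0 * (1ℚ + ofℕ k))
    {{pos*pos⇒pos (pochS (lin 1ℚ 1ℚ) k 0) {{pochS-den0-pos k}} (1ℚ + ofℕ k) {{1+ofℕ-pos k}}}}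
    0ℚ {{_}}

expansion : ℕ → Series
expansion k =
  pochS (lin ⅓ (- 1ℚ)) k
    ⊛ invSeries (pochS (lin 1ℚ 1ℚ) k)
        {{pos⇒nonZero (pochS (lin 1ℚ 1ℚ) k 0) {{pochS-den0-pos k}}}}

leading : ℕ → ℚ
leading k = pochℚ ⅓ k * (1/ pochℚ 1ℚ k) {{pos⇒nonZero (pochℚ 1ℚ k) {{pochℚ1-pos k}}}}

-- t = 1 if p ≡ 1 (mod 6), t = 2 otherwise (i.e. p ≡ 5 (mod 6) for primes p ≥ 5)
tOf : ℕ → ℕ
tOf p = if p % 6 ≡ᵇ 1 then 1 else 2

module Submission where

-- Numerator and denominator are products of linear factors with
-- p-integral coefficients, so all their coefficients are p-integral.  The
-- constant term of the denominator is (1)_k = k!, and that of the numerator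
-- is (1/3)_k = ∏_{j<k} (3j+1)/3; the bound on k guarantees that p divides
-- none of j+1 and 3j+1 (j < k), so both constant terms are p-adic units.
-- The inverse of a series with p-integral coefficients and unit constant
-- term has p-integral coefficients, hence so does the expansion; its
-- constant term (1/3)_k/(1)_k is a unit, and dividing by it gives the aᵢ.

open import Defs
open import Data.Nat as ℕ
  using (ℕ; zero; suc; _≤_; _<_; z≤n; s≤s; _*_; _∸_; _%_; _≡ᵇ_)
open import Data.Nat.Properties as ℕP using ()
open import Data.Nat.Divisibility using (_∣_; divides; ∣-trans; ∣⇒≤; _∣0; ∣1⇒≡1)
open import Data.Nat.Coprimality as Coprime using (coprime-divisor)
open import Data.Nat.Primality using (Prime; prime; euclidsLemma; prime⇒irreducible)
open import Data.Nat.DivMod using ([m+kn]%n≡m%n)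
open import Data.Nat.Tactic.RingSolver using (solve-∀)
open import Data.Integer as ℤ using (ℤ; +_; +[1+_]; -[1+_]; +0)
import Data.Integer.Properties as ℤP
open import Data.Rational as ℚ using (ℚ; mkℚ; 0ℚ; 1ℚ; _+_; -_; 1/_)
  renaming (_*_ to _*ℚ_; NonZero to NonZeroℚ)
open import Data.Rational.Properties as ℚP using (toℚᵘ-homo-+; toℚᵘ-homo-*)
open import Data.Rational.Unnormalised as ℚᵘ using (ℚᵘ; mkℚᵘ; *≡*)
open import Data.List using (List; []; _∷_; map; zipWith; upTo)
open import Data.List.Relation.Unary.All using (All; []; _∷_; universal)
open import Data.List.Relation.Unary.All.Properties using (map⁺)
open import Data.Bool using (true; false; if_then_else_)
open import Data.Product using (Σ; _×_; _,_; proj₂)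
open import Data.Sum using (_⊎_; inj₁; inj₂)
open import Data.Empty using (⊥)
open import Relation.Nullary using (¬_; Dec; contradiction; yes; no)
open import Relation.Binary.PropositionalEquality

cross-abs : ∀ (n m : ℤ) (d e : ℕ) → n ℤ.* + e ≡ m ℤ.* + d →
            ℤ.∣ n ∣ * e ≡ ℤ.∣ m ∣ * d
cross-abs n m d e eq =
  trans (sym (ℤP.abs-* n (+ e))) (trans (cong ℤ.∣_∣ eq) (ℤP.abs-* m (+ d)))

reduced-denominator-∣ : (q : ℚ) (x : ℚᵘ) → ℚ.toℚᵘ q ℚᵘ.≃ x →
                        ℚ.denominatorℕ q ∣ ℚᵘ.↧ₙ x
reduced-denominator-∣ (mkℚ n d c) (mkℚᵘ m e) (*≡* eq) =
  coprime-divisor (Coprime.sym (Coprime.recompute c))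
    (divides ℤ.∣ m ∣ (cross-abs n m (suc d) (suc e) eq))

reduced-numerator-∣ : (q : ℚ) (x : ℚᵘ) → ℚ.toℚᵘ q ℚᵘ.≃ x →
                      ℤ.∣ ℚ.numerator q ∣ ∣ ℤ.∣ ℚᵘ.↥ x ∣
reduced-numerator-∣ (mkℚ n d c) (mkℚᵘ m e) (*≡* eq) =
  coprime-divisor (Coprime.recompute c)
    (divides (suc e) (trans (ℕP.*-comm (suc d) ℤ.∣ m ∣)
                            (sym (trans (ℕP.*-comm (suc e) ℤ.∣ n ∣)
                                        (cross-abs n m (suc d) (suc e) eq)))))

pochS-constant : ∀ a k → pochS a k 0 ≡ pochℚ (a 0) k
pochS-constant a zero    = refl
pochS-constant a (suc k) =
  trans (ℚP.+-identityʳ _) (cong (_*ℚ (a 0 + ofℕ k)) (pochS-constant a k))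

1/-cong : ∀ {q r} → q ≡ r → .{{_ : NonZeroℚ q}} .{{_ : NonZeroℚ r}} → 1/ q ≡ 1/ r
1/-cong refl = refl

expansion-constant : ∀ k → expansion k 0 ≡ leading k
expansion-constant k =
  trans (ℚP.+-identityʳ _)
    (cong₂ _*ℚ_ (pochS-constant (lin ⅓ (- 1ℚ)) k)
      (1/-cong (pochS-constant (lin 1ℚ 1ℚ) k)
        {{ℚP.pos⇒nonZero (pochS (lin 1ℚ 1ℚ) k 0) {{pochS-den0-pos k}}}}
        {{ℚP.pos⇒nonZero (pochℚ 1ℚ k) {{pochℚ1-pos k}}}}))

prime∤1 : ∀ {p} → Prime p → ¬ p ∣ 1
prime∤1 (prime _) p∣1 = ℕ.nonTrivial⇒≢1 (∣1⇒≡1 p∣1)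

module pAdic {p : ℕ} (pp : Prime p) where

  Integral : ℚ → Set
  Integral = pIntegral p

  Unit : ℚ → Set
  Unit q = ¬ p ∣ ℤ.∣ ℚ.numerator q ∣ × Integral q

  p∤1 : ¬ p ∣ 1
  p∤1 = prime∤1 pp

  p∤* : ∀ {a b} → ¬ p ∣ a → ¬ p ∣ b → ¬ p ∣ a * b
  p∤* {a} {b} p∤a p∤b p∣ab with euclidsLemma a b pp p∣ab
  ... | inj₁ p∣a = p∤a p∣a
  ... | inj₂ p∣b = p∤b p∣b

  integral-via : (q : ℚ) (x : ℚᵘ) → ℚ.toℚᵘ q ℚᵘ.≃ x →
                 ¬ p ∣ ℚᵘ.↧ₙ x → Integral q
  integral-via q x q≃x p∤e p∣d = p∤e (∣-trans p∣d (reduced-denominator-∣ q x q≃x))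

  unit-via : (q : ℚ) (x : ℚᵘ) → ℚ.toℚᵘ q ℚᵘ.≃ x →
             ¬ p ∣ ℤ.∣ ℚᵘ.↥ x ∣ → ¬ p ∣ ℚᵘ.↧ₙ x → Unit q
  unit-via q x q≃x p∤m p∤e =
    (λ p∣n → p∤m (∣-trans p∣n (reduced-numerator-∣ q x q≃x))) , integral-via q x q≃x p∤e

  integral-0 : Integral 0ℚ
  integral-0 = p∤1

  integral-ofℕ : ∀ n → Integral (ofℕ n)
  integral-ofℕ n = p∤1

  unit-1 : Unit 1ℚ
  unit-1 = p∤1 , p∤1

  integral-+ : ∀ q r → Integral q → Integral r → Integral (q + r)
  integral-+ q@(mkℚ _ _ _) r@(mkℚ _ _ _) iq ir =
    integral-via (q + r) _ (toℚᵘ-homo-+ q r) (p∤* iq ir)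

  integral-* : ∀ q r → Integral q → Integral r → Integral (q *ℚ r)
  integral-* q@(mkℚ _ _ _) r@(mkℚ _ _ _) iq ir =
    integral-via (q *ℚ r) _ (toℚᵘ-homo-* q r) (p∤* iq ir)

  integral-neg : ∀ q → Integral q → Integral (- q)
  integral-neg (mkℚ +0         _ _) iq = iq
  integral-neg (mkℚ +[1+ _ ]   _ _) iq = iq
  integral-neg (mkℚ -[1+ _ ]   _ _) iq = iq

  unit-* : ∀ q r → Unit q → Unit r → Unit (q *ℚ r)
  unit-* q@(mkℚ n _ _) r@(mkℚ m _ _) (p∤n , iq) (p∤m , ir) =
    unit-via (q *ℚ r) _ (toℚᵘ-homo-* q r)
      (λ p∣nm → p∤* p∤n p∤m (subst (p ∣_) (ℤP.abs-* n m) p∣nm)) (p∤* iq ir)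

  unit-inverse : ∀ q .{{_ : NonZeroℚ q}} → Unit q → Unit (1/ q)
  unit-inverse (mkℚ +[1+ _ ] _ _) (p∤n , p∤d) = p∤d , p∤n
  unit-inverse (mkℚ -[1+ _ ] _ _) (p∤n , p∤d) = p∤d , p∤n

  unit⇒nonZero : ∀ q → Unit q → NonZeroℚ q
  unit⇒nonZero (mkℚ +0       _ _) (p∤n , _) = contradiction (p ∣0) p∤n
  unit⇒nonZero (mkℚ +[1+ _ ] _ _) _ = _
  unit⇒nonZero (mkℚ -[1+ _ ] _ _) _ = _

  pochℚ-unit : ∀ a k → (∀ j → j < k → Unit (a + ofℕ j)) → Unit (pochℚ a k)
  pochℚ-unit a zero    _     = unit-1
  pochℚ-unit a (suc k) units =
    unit-* (pochℚ a k) (a + ofℕ k)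
      (pochℚ-unit a k (λ j j<k → units j (ℕP.m<n⇒m<1+n j<k))) (units k ℕP.≤-refl)

  one-plus-unit : ∀ j → ¬ p ∣ suc j → Unit (1ℚ + ofℕ j)
  one-plus-unit j p∤j+1 =
    unit-via (1ℚ + ofℕ j) (mkℚᵘ (+ 1) 0 ℚᵘ.+ mkℚᵘ (+ j) 0) (toℚᵘ-homo-+ 1ℚ (ofℕ j))
      (λ p∣ → p∤j+1 (subst (p ∣_) numerator≡ p∣)) p∤1
    where
    numerator≡ : ℤ.∣ + 1 ℤ.+ + j ℤ.* + 1 ∣ ≡ suc j
    numerator≡ = cong (λ z → ℤ.∣ + 1 ℤ.+ z ∣) (ℤP.*-identityʳ (+ j))

  -- 1/3 + j = (3j + 1)/3 is a unit when p ∤ 3 and p ∤ 3j + 1.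
  third-plus-unit : ∀ j → ¬ p ∣ 3 → ¬ p ∣ suc (j * 3) → Unit (⅓ + ofℕ j)
  third-plus-unit j p∤3 p∤3j+1 =
    unit-via (⅓ + ofℕ j) (mkℚᵘ (+ 1) 2 ℚᵘ.+ mkℚᵘ (+ j) 0) (toℚᵘ-homo-+ ⅓ (ofℕ j))
      (λ p∣ → p∤3j+1 (subst (p ∣_) numerator≡ p∣)) p∤3
    where
    numerator≡ : ℤ.∣ + 1 ℤ.+ + j ℤ.* + 3 ∣ ≡ suc (j * 3)
    numerator≡ = cong (λ z → ℤ.∣ + 1 ℤ.+ z ∣) (sym (ℤP.pos-* j 3))

  IntegralSeries : Series → Set
  IntegralSeries f = ∀ n → Integral (f n)

  integral-sum : ∀ l → All Integral l → Integral (sumℚ l)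
  integral-sum []      []        = integral-0
  integral-sum (q ∷ l) (iq ∷ il) = integral-+ q (sumℚ l) iq (integral-sum l il)

  integral-zipWith* : ∀ xs ys → All Integral xs → All Integral ys →
                      All Integral (zipWith _*ℚ_ xs ys)
  integral-zipWith* []       _        _         _         = []
  integral-zipWith* (_ ∷ _)  []       _         _         = []
  integral-zipWith* (x ∷ xs) (y ∷ ys) (ix ∷ ixs) (iy ∷ iys) =
    integral-* x y ix iy ∷ integral-zipWith* xs ys ixs iys

  integral-⊕ : ∀ f g → IntegralSeries f → IntegralSeries g → IntegralSeries (f ⊕ g)
  integral-⊕ f g if ig n = integral-+ (f n) (g n) (if n) (ig n)

  integral-⊛ : ∀ f g → IntegralSeries f → IntegralSeries g → IntegralSeries (f ⊛ g)
  integral-⊛ f g if ig n =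
    integral-sum _ (map⁺ {f = λ i → f i *ℚ g (n ∸ i)} (universal term (upTo (suc n))))
    where
    term : ∀ i → Integral (f i *ℚ g (n ∸ i))
    term i = integral-* (f i) (g (n ∸ i)) (if i) (ig (n ∸ i))

  integral-cst : ∀ c → Integral c → IntegralSeries (cst c)
  integral-cst c ic zero    = ic
  integral-cst c ic (suc n) = integral-0

  integral-lin : ∀ c d → Integral c → Integral d → IntegralSeries (lin c d)
  integral-lin c d ic id zero          = ic
  integral-lin c d ic id (suc zero)    = id
  integral-lin c d ic id (suc (suc n)) = integral-0

  integral-pochS : ∀ a → IntegralSeries a → ∀ k → IntegralSeries (pochS a k)
  integral-pochS a ia zero    = integral-cst 1ℚ p∤1
  integral-pochS a ia (suc k) =
    integral-⊛ (pochS a k) (a ⊕ cst (ofℕ k)) (integral-pochS a ia k)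
      (integral-⊕ a (cst (ofℕ k)) ia (integral-cst (ofℕ k) (integral-ofℕ k)))

  -- The recursion b_n = -u Σ_{i≥1} s_i b_{n-i} preserves integrality when
  -- s and u are integral; with u = 1/s₀ a unit this is the inverse series.
  module _ (s : Series) (u : ℚ) (is : IntegralSeries s) (iu : Integral u) where
    open Inverse s u

    integral-next : ∀ m l → All Integral l → Integral (next m l)
    integral-next zero    l _  = iu
    integral-next (suc m) l il =
      integral-neg (u *ℚ weighted) (integral-* u weighted iu
        (integral-sum (zipWith _*ℚ_ shifted l) (integral-zipWith* shifted l
          (map⁺ {f = λ i → s (suc i)} (universal (λ i → is (suc i)) (upTo (suc m)))) il)))
      where
      shifted : List ℚ
      shifted = map (λ i → s (suc i)) (upTo (suc m))
      weighted : ℚ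
      weighted = sumℚ (zipWith _*ℚ_ shifted l)

    integral-revPrefix : ∀ n → All Integral (revPrefix n)
    integral-revPrefix zero    = []
    integral-revPrefix (suc n) =
      integral-next n (revPrefix n) (integral-revPrefix n) ∷ integral-revPrefix n

    integral-inverse : IntegralSeries coeff
    integral-inverse n = integral-next n (revPrefix n) (integral-revPrefix n)

  expansion-integral : ∀ k → ¬ p ∣ 3 → Unit (pochℚ 1ℚ k) → IntegralSeries (expansion k)
  expansion-integral k p∤3 unit-1_k =
    integral-⊛ numerator _ (integral-pochS _ (integral-lin ⅓ (- 1ℚ) p∤3 (integral-neg 1ℚ p∤1)) k)
      (integral-inverse denominator (1/ denominator 0) integral-denominator
        (proj₂ (unit-inverse (denominator 0) unit-d₀)))
    where
    numerator denominator : Series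
    numerator = pochS (lin ⅓ (- 1ℚ)) k
    denominator = pochS (lin 1ℚ 1ℚ) k
    instance
      d₀≢0 : NonZeroℚ (denominator 0)
      d₀≢0 = ℚP.pos⇒nonZero (denominator 0) {{pochS-den0-pos k}}
    unit-d₀ : Unit (denominator 0)
    unit-d₀ = subst Unit (sym (pochS-constant (lin 1ℚ 1ℚ) k)) unit-1_k
    integral-denominator : IntegralSeries denominator
    integral-denominator = integral-pochS _ (integral-lin 1ℚ 1ℚ p∤1 p∤1) k

  normalise-by-unit : (f : Series) (c : ℚ) → IntegralSeries f →
    f 0 ≡ c → Unit c →
    Σ (ℕ → ℚ) (λ a → (a 0 ≡ 1ℚ) × (∀ i → Integral (a i)) × (∀ n → f n ≡ c *ℚ a n))
  normalise-by-unit f c integral f0≡c unit-c =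
    (λ n → 1/ c *ℚ f n) , leading-one , (λ i → integral-* (1/ c) (f i) inv-integral (integral i)) , factor
    where
    instance
      c≢0 : NonZeroℚ c
      c≢0 = unit⇒nonZero c unit-c
    inv-integral : Integral (1/ c)
    inv-integral = proj₂ (unit-inverse c unit-c)
    leading-one : 1/ c *ℚ f 0 ≡ 1ℚ
    leading-one = trans (cong (1/ c *ℚ_) f0≡c) (ℚP.*-inverseˡ c)
    factor : ∀ n → f n ≡ c *ℚ (1/ c *ℚ f n)
    factor n = begin
      f n                  ≡⟨ sym (ℚP.*-identityˡ (f n)) ⟩
      1ℚ *ℚ f n            ≡⟨ cong (_*ℚ f n) (sym (ℚP.*-inverseʳ c)) ⟩
      (c *ℚ 1/ c) *ℚ f n   ≡⟨ ℚP.*-assoc c (1/ c) (f n) ⟩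
      c *ℚ (1/ c *ℚ f n)   ∎
      where open ≡-Reasoning

tOf≤2 : ∀ p → tOf p ≤ 2
tOf≤2 p = if-bound (p % 6 ≡ᵇ 1)
  where
  if-bound : ∀ b → (if b then 1 else 2) ≤ 2
  if-bound true  = s≤s z≤n
  if-bound false = ℕP.≤-refl

tOf≡1 : ∀ {p} → p % 6 ≡ 1 → tOf p ≡ 1
tOf≡1 e = cong (λ r → if r ≡ᵇ 1 then 1 else 2) e

multiple-below-double : ∀ {p m} → p ∣ m → 0 < m → m < 2 * p → m ≡ p
multiple-below-double         (divides zero          refl) () _
multiple-below-double {p}     (divides (suc zero)    eq)   _  _    =
  trans eq (ℕP.+-identityʳ p)
multiple-below-double {p}     (divides (suc (suc q)) eq)   _  m<2p =
  contradiction m<2p (ℕP.≤⇒≯ (subst (2 * p ≤_) (sym eq) (ℕP.*-monoˡ-≤ p (s≤s (s≤s (z≤n {q}))))))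

even-or-odd : ∀ j → (Σ ℕ λ h → j ≡ h * 2) ⊎ (Σ ℕ λ h → j ≡ suc (h * 2))
even-or-odd zero = inj₁ (0 , refl)
even-or-odd (suc j) with even-or-odd j
... | inj₁ (h , e) = inj₂ (h , cong suc e)
... | inj₂ (h , e) = inj₁ (suc h , cong suc e)

-- A prime p ≥ 5 of the form 3j + 1 is ≡ 1 (mod 6), since it is odd.
prime≡1mod3⇒≡1mod6 : ∀ {p} j → Prime p → 5 ≤ p → p ≡ suc (j * 3) → p % 6 ≡ 1
prime≡1mod3⇒≡1mod6 {p} j pp 5≤p p≡ = by-parity (even-or-odd j)
  where
  p≡of : ∀ {i} → j ≡ i → p ≡ suc (i * 3)
  p≡of j≡i = trans p≡ (cong (λ x → suc (x * 3)) j≡i)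

  even-case : ∀ h → suc (h * 2 * 3) ≡ 1 ℕ.+ h * 6
  even-case = solve-∀
  odd-case : ∀ h → suc (suc (h * 2) * 3) ≡ (2 ℕ.+ h * 3) * 2
  odd-case = solve-∀

  p≢2 : ¬ 2 ≡ p
  p≢2 2≡p = contradiction (subst (5 ≤_) (sym 2≡p) 5≤p) λ { (s≤s (s≤s ())) }

  by-parity : (Σ ℕ λ h → j ≡ h * 2) ⊎ (Σ ℕ λ h → j ≡ suc (h * 2)) → p % 6 ≡ 1
  by-parity (inj₁ (h , even)) =
    trans (cong (_% 6) (trans (p≡of even) (even-case h))) ([m+kn]%n≡m%n 1 h 6)
  by-parity (inj₂ (h , odd)) with
    prime⇒irreducible pp {2} (divides (2 ℕ.+ h * 3) (trans (p≡of odd) (odd-case h)))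
  ... | inj₁ ()
  ... | inj₂ 2≡p = contradiction 2≡p p≢2

module Bounds {p k : ℕ} (pp : Prime p) (5≤p : 5 ≤ p) (hk : 3 * k ≤ tOf p * p ∸ 1) where

  -- For j < k we have 3(j + 1) ≤ 3k ≤ tp - 1 < tp.
  below-tp : ∀ {j} → j < k → 3 * suc j < tOf p * p
  below-tp {j} j<k = ≤∸1⇒< (ℕP.≤-trans (ℕP.*-monoʳ-≤ 3 j<k) hk)
    where
    ≤∸1⇒< : ∀ {m n} → suc m ≤ n ∸ 1 → suc m < n
    ≤∸1⇒< {n = suc n} le = s≤s le

  tp≤2p : tOf p * p ≤ 2 * p
  tp≤2p = ℕP.*-monoˡ-≤ p (tOf≤2 p)

  -- p ∤ j + 1 because j + 1 < p.
  p∤suc : ∀ {j} → j < k → ¬ p ∣ suc j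
  p∤suc {j} j<k p∣ = ℕP.<-irrefl refl (begin-strict
    3 * p        ≤⟨ ℕP.*-monoʳ-≤ 3 (∣⇒≤ p∣) ⟩
    3 * suc j    <⟨ below-tp j<k ⟩
    tOf p * p    ≤⟨ tp≤2p ⟩
    2 * p        ≤⟨ ℕP.*-monoˡ-≤ p (s≤s (s≤s (z≤n {1}))) ⟩
    3 * p        ∎)
    where open ℕP.≤-Reasoning

  suc-3*<tp : ∀ {j} → j < k → suc (j * 3) < tOf p * p
  suc-3*<tp {j} j<k =
    ℕP.≤-<-trans (subst (suc (j * 3) ≤_) (sum≡ j) (ℕP.m≤m+n (suc (j * 3)) 2)) (below-tp j<k)
    where
    sum≡ : ∀ j → suc (j * 3) ℕ.+ 2 ≡ 3 * suc j
    sum≡ = solve-∀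

  -- p ∤ 3j + 1: as 3j + 1 < tp ≤ 2p, divisibility forces 3j + 1 = p, which
  -- is impossible if t = 1 (then 3j + 1 < p) and if t = 2 (then p ≢ 1 mod 6).
  p∤suc-3* : ∀ {j} → j < k → ¬ p ∣ suc (j * 3)
  p∤suc-3* {j} j<k p∣ = excluded (p % 6 ℕ.≟ 1)
    where
    3j+1≡p : suc (j * 3) ≡ p
    3j+1≡p = multiple-below-double p∣ (s≤s z≤n) (ℕP.<-≤-trans (suc-3*<tp j<k) tp≤2p)

    excluded : Dec (p % 6 ≡ 1) → ⊥
    excluded (yes p%6≡1) = ℕP.<-irrefl 3j+1≡p (subst (suc (j * 3) <_) (ℕP.*-identityˡ p)
                             (subst (λ t → suc (j * 3) < t * p) (tOf≡1 {p} p%6≡1) (suc-3*<tp j<k)))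
    excluded (no p%6≢1)  = p%6≢1 (prime≡1mod3⇒≡1mod6 j pp 5≤p (sym 3j+1≡p))

lemma4p1 : (p : ℕ) → Prime p → 5 ≤ p → (k : ℕ) → 3 * k ≤ tOf p * p ∸ 1 →
    ((n : ℕ) → pIntegral p (expansion k n)) ×
    Σ (ℕ → ℚ) (λ a → (a 0 ≡ 1ℚ) × ((i : ℕ) → pIntegral p (a i)) ×
    ((n : ℕ) → expansion k n ≡ leading k *ℚ a n))
lemma4p1 p pp 5≤p k hk =
  integral , normalise-by-unit (expansion k) (leading k) integral (expansion-constant k) leading-unit
  where
  open pAdic pp
  open Bounds {p} {k} pp 5≤p hk

  p∤3 : ¬ p ∣ 3
  p∤3 p∣3 = contradiction (ℕP.≤-trans 5≤p (∣⇒≤ p∣3)) λ { (s≤s (s≤s (s≤s ()))) }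

  -- (1/3)_k and (1)_k are units: p divides none of 3j + 1 and j + 1 for j < k.
  numerator-unit : Unit (pochℚ ⅓ k)
  numerator-unit = pochℚ-unit ⅓ k (λ j j<k → third-plus-unit j p∤3 (p∤suc-3* j<k))

  denominator-unit : Unit (pochℚ 1ℚ k)
  denominator-unit = pochℚ-unit 1ℚ k (λ j j<k → one-plus-unit j (p∤suc j<k))

  leading-unit : Unit (leading k)
  leading-unit = unit-* (pochℚ ⅓ k) _ numerator-unit
    (unit-inverse (pochℚ 1ℚ k) {{ℚP.pos⇒nonZero (pochℚ 1ℚ k) {{pochℚ1-pos k}}}} denominator-unit)

  integral : IntegralSeries (expansion k)
  integral = expansion-integral k p∤3 denominator-unit
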